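{- Let $H$ be a connected simple graph with $\Delta(H)\geq 3$ and $\chi''_a(H)\leq\Delta(H)+3$. Suppose $\alpha(H)\geq 2$ and let $u_1,u_2$ be any two non-adjacent vertices of $H$. Then for every color $c\in[\Delta(H)+1]$ there is an avd total $(\Delta(H)+3)$-coloring $f$ of $H$ (with colors from $[\Delta(H)+3]$) such that $\Delta(H)+2\in\overline{C_f(u_1)}$, $\Delta(H)+3\in\overline{C_f(u_2)}$, $f(u_1)\neq c$ and $f(u_2)\neq c$.
   Context: All graphs are finite and simple; $\Delta(H)$ is the maximum degree and $\alpha(H)$ the independence number of $H$; $[k]=\{1,\ldots,k\}$. A proper total $k$-coloring of $H=(V,E)$ is a map $f:V\cup E\to[k]$ such that adjacent vertices get different colors, adjacent edges get different colors, and each edge gets a color different from the colors of its endvertices. The color set of $v$ is $C_f(v)=\{f(v)\}\cup\{f(vu): vu\in E\}$, and $\overline{C_f(v)}=[k]\setminus C_f(v)$ is the set of missing colors at $v$. An adjacent vertex distinguishing (avd) total $k$-coloring is a proper total $k$-coloring with $C_f(u)\neq C_f(v)$ for every edge $uv$; $\chi''_a(H)$ is the least such $k$. -}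

module Defs where

open import Data.Nat using (ℕ; zero; suc; _+_; _≤_; _⊔_)
open import Data.Fin using (Fin)
open import Data.Bool using (Bool; true; false; if_then_else_)
open import Data.List using (List; map; foldr; allFin)
open import Data.Nat.ListAction using (sum)
open import Data.Product using (Σ; ∃; ∃-syntax; _×_; _,_)
open import Data.Sum using (_⊎_)
open import Relation.Binary.PropositionalEquality using (_≡_; _≢_)
open import Relation.Nullary using (¬_)
open import Function.Bundles using (_⇔_)

record Graph : Set where
  field
    n      : ℕ
    adj    : Fin n → Fin n → Bool
    adj-sym    : ∀ u v → adj u v ≡ adj v u
    adj-irrefl : ∀ v → adj v v ≡ false

module _ (H : Graph) where
  open Graph H

  Vertex : Set
  Vertex = Fin n

  Edge : Vertex → Vertex → Set
  Edge u v = adj u v ≡ true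

  degree : Vertex → ℕ
  degree v = sum (map (λ w → if adj v w then 1 else 0) (allFin n))

  -- Δ(H): maximum degree (0 for the empty graph)
  maxDegree : ℕ
  maxDegree = foldr _⊔_ 0 (map degree (allFin n))

  data Reachable (u : Vertex) : Vertex → Set where
    here : Reachable u u
    step : ∀ {v w} → Reachable u v → Edge v w → Reachable u w

  Connected : Set
  Connected = ∀ u v → Reachable u v

  IndependenceAtLeast2 : Set
  IndependenceAtLeast2 = Σ Vertex λ u → Σ Vertex λ v → u ≢ v × ¬ Edge u v

  InRange : ℕ → ℕ → Set
  InRange k c = 1 ≤ c × c ≤ k

  -- A total colouring: colours for vertices and for ordered pairs of vertices;
  -- only the values on edges matter (and they are required to be symmetric).
  record TotalColouring : Set where
    field
      vcol : Vertex → ℕ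
      ecol : Vertex → Vertex → ℕ

  module _ (f : TotalColouring) where
    open TotalColouring f

    _∈C_ : ℕ → Vertex → Set
    c ∈C v = (c ≡ vcol v) ⊎ (∃[ u ] (Edge v u × ecol v u ≡ c))

    IsProperTotal : ℕ → Set
    IsProperTotal k =
        (∀ v → InRange k (vcol v))
      × (∀ u v → Edge u v → InRange k (ecol u v))
      × (∀ u v → Edge u v → ecol u v ≡ ecol v u)
      × (∀ u v → Edge u v → vcol u ≢ vcol v)
      × (∀ u v w → Edge u v → Edge u w → v ≢ w → ecol u v ≢ ecol u w)
      × (∀ u v → Edge u v → ecol u v ≢ vcol u)

    IsAvdTotal : ℕ → Set
    IsAvdTotal k =
        IsProperTotal k
      × (∀ u v → Edge u v → ¬ (∀ c → (c ∈C u) ⇔ (c ∈C v)))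

  HasAvdTotal : ℕ → Set
  HasAvdTotal k = Σ TotalColouring λ f → IsAvdTotal f k

  ChiAvdAtMost : ℕ → Set
  ChiAvdAtMost k = ∃[ k' ] (k' ≤ k × HasAvdTotal k')

{-# OPTIONS --safe #-}
-- A permutation of the colours maps avd total colourings to avd total colourings
-- and carries the missing colours along.  As |C_f(v)| ≤ Δ + 1, some b ∈ [Δ+3] is
-- missing at u₂ and some a ≠ b is missing at u₁; a permutation sending a ↦ Δ+2 and
-- b ↦ Δ+3 settles the first two requirements.  Then choose d ∈ [3] ⊆ [Δ+1] distinct
-- from both vertex colours and swap c with d: this fixes Δ+2 and Δ+3, and afterwards
-- neither u₁ nor u₂ is coloured c.
module Submission where

open import Defs
open import Data.Nat using (ℕ; zero; suc; _+_; _≤_; _<_; _⊔_; z≤n; s≤s; _≟_)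
open import Data.Nat.Properties
open import Data.Bool using (true; false; if_then_else_)
import Data.Bool as Bool
open import Data.List using (List; []; _∷_; map; foldr; filter; allFin; length)
open import Data.List.Properties using (length-map; filter-notAll)
open import Data.List.Membership.Propositional using (_∈_; _∉_)
open import Data.List.Membership.Propositional.Properties using (∈-allFin; ∈-map⁺; ∈-filter⁺)
open import Data.List.Membership.DecPropositional _≟_ using (_∈?_)
open import Data.List.Relation.Unary.Any using (here; there)
import Data.List.Relation.Unary.Any as Any
open import Data.Nat.ListAction using (sum)
open import Data.Product using (Σ; ∃; ∃₂; _×_; _,_)
open import Data.Sum using (inj₁; inj₂)
open import Function using (_∘_)
open import Function.Bundles using (mk⇔; Equivalence)
open import Function.Definitions using (Injective)
open import Relation.Binary.PropositionalEquality
open import Relation.Nullary using (¬_; yes; no; ¬?; contradiction)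

infix 4 _∈[_]
_∈[_] : ℕ → ℕ → Set
c ∈[ k ] = 1 ≤ c × c ≤ k

∈[]-mono : ∀ {c k K} → k ≤ K → c ∈[ k ] → c ∈[ K ]
∈[]-mono k≤K (1≤c , c≤k) = 1≤c , ≤-trans c≤k k≤K

∃-∈[]-∉ : ∀ K (L : List ℕ) → length L < K → ∃ λ c → c ∈[ K ] × c ∉ L
∃-∈[]-∉ zero L ()
∃-∈[]-∉ (suc K) L |L|<1+K with suc K ∈? L
... | no 1+K∉L = suc K , (s≤s z≤n , ≤-refl) , 1+K∉L
... | yes 1+K∈L with ∃-∈[]-∉ K (filter (¬? ∘ (_≟ suc K)) L) |L'|<K
  where
  |L'|<K : length (filter (¬? ∘ (_≟ suc K)) L) < K
  |L'|<K = <-≤-trans (filter-notAll _ L (Any.map (λ 1+K≡x x≢1+K → x≢1+K (sym 1+K≡x)) 1+K∈L))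
                     (≤-pred |L|<1+K)
...   | c , (1≤c , c≤K) , c∉L' =
  c , (1≤c , m≤n⇒m≤1+n c≤K) , λ c∈L → c∉L' (∈-filter⁺ _ c∈L (<⇒≢ (s≤s c≤K)))

n+2<n+3 : ∀ n → n + 2 < n + 3
n+2<n+3 n = +-monoʳ-< n ≤-refl

foldr-⊔-upper : ∀ {x xs} → x ∈ xs → x ≤ foldr _⊔_ 0 xs
foldr-⊔-upper {x} (here refl) = m≤m⊔n x _
foldr-⊔-upper {xs = y ∷ _} (there x∈xs) = ≤-trans (foldr-⊔-upper x∈xs) (m≤n⊔m y _)

transpose : ℕ → ℕ → ℕ → ℕ
transpose s t z with z ≟ s | z ≟ t
... | yes _ | _     = t
... | no _  | yes _ = s
... | no _  | no _  = z

module _ {s t : ℕ} where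

  transpose-fromˡ : transpose s t s ≡ t
  transpose-fromˡ with s ≟ s
  ... | yes _ = refl
  ... | no s≢s = contradiction refl s≢s

  transpose-fromʳ : transpose s t t ≡ s
  transpose-fromʳ with t ≟ s | t ≟ t
  ... | yes t≡s | _     = t≡s
  ... | no _    | yes _ = refl
  ... | no _    | no t≢t = contradiction refl t≢t

  transpose-fix : ∀ {z} → z ≢ s → z ≢ t → transpose s t z ≡ z
  transpose-fix {z} z≢s z≢t with z ≟ s | z ≟ t
  ... | yes z≡s | _       = contradiction z≡s z≢s
  ... | no _    | yes z≡t = contradiction z≡t z≢t
  ... | no _    | no _    = refl

  transpose-involutive : ∀ z → transpose s t (transpose s t z) ≡ z
  transpose-involutive z with z ≟ s | z ≟ t
  ... | yes refl | _       = transpose-fromʳ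
  ... | no _     | yes refl = transpose-fromˡ
  ... | no z≢s   | no z≢t  = transpose-fix z≢s z≢t

  transpose-injective : Injective _≡_ _≡_ (transpose s t)
  transpose-injective {x} {y} eq = begin
    x                                 ≡⟨ transpose-involutive x ⟨
    transpose s t (transpose s t x)   ≡⟨ cong (transpose s t) eq ⟩
    transpose s t (transpose s t y)   ≡⟨ transpose-involutive y ⟩
    y                                 ∎
    where open ≡-Reasoning

  transpose-≢ˡ : ∀ {z} → z ≢ t → transpose s t z ≢ s
  transpose-≢ˡ z≢t eq = z≢t (transpose-injective (trans eq (sym transpose-fromʳ)))

  transpose-preserves : ∀ (P : ℕ → Set) {z} → P s → P t → P z → P (transpose s t z)
  transpose-preserves P {z} Ps Pt Pz with z ≟ s | z ≟ t
  ... | yes _ | _     = Pt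
  ... | no _  | yes _ = Ps
  ... | no _  | no _  = Pz

transpose₂ : ℕ → ℕ → ℕ → ℕ → ℕ → ℕ
transpose₂ a p b q = transpose (transpose a p b) q ∘ transpose a p

module _ {a p b q : ℕ} where

  transpose₂-injective : Injective _≡_ _≡_ (transpose₂ a p b q)
  transpose₂-injective = transpose-injective ∘ transpose-injective

  transpose₂-preserves : ∀ (P : ℕ → Set) {z} → P a → P p → P b → P q → P z → P (transpose₂ a p b q z)
  transpose₂-preserves P Pa Pp Pb Pq Pz =
    transpose-preserves P (transpose-preserves P Pa Pp Pb) Pq (transpose-preserves P Pa Pp Pz)

  transpose₂-fromˡ : a ≢ b → p ≢ q → transpose₂ a p b q a ≡ p
  transpose₂-fromˡ a≢b p≢q = begin
    transpose (transpose a p b) q (transpose a p a)   ≡⟨ cong (transpose _ q) (transpose-fromˡ {a} {p}) ⟩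
    transpose (transpose a p b) q p                   ≡⟨ transpose-fix p≢b' p≢q ⟩
    p                                                 ∎
    where
    open ≡-Reasoning
    p≢b' : p ≢ transpose a p b
    p≢b' p≡b' = a≢b (transpose-injective (trans (transpose-fromˡ {a} {p}) p≡b'))

  transpose₂-fromʳ : transpose₂ a p b q b ≡ q
  transpose₂-fromʳ = transpose-fromˡ {transpose a p b} {q}

module _ (H : Graph) where
  open Graph H

  private
    Δ : ℕ
    Δ = maxDegree H

  degree≤maxDegree : ∀ v → degree H v ≤ Δ
  degree≤maxDegree v = foldr-⊔-upper (∈-map⁺ (degree H) (∈-allFin v))

  neighbours : Vertex H → List (Vertex H)
  neighbours v = filter (λ w → adj v w Bool.≟ true) (allFin n)

  length-neighbours : ∀ v → length (neighbours v) ≡ degree H v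
  length-neighbours v = count (allFin n)
    where
    count : ∀ ws → length (filter (λ w → adj v w Bool.≟ true) ws)
                 ≡ sum (map (λ w → if adj v w then 1 else 0) ws)
    count [] = refl
    count (w ∷ ws) with adj v w
    ... | true  = cong suc (count ws)
    ... | false = count ws

  recolour : (ℕ → ℕ) → TotalColouring H → TotalColouring H
  recolour π f = record
    { vcol = π ∘ TotalColouring.vcol f
    ; ecol = λ u v → π (TotalColouring.ecol f u v)
    }

  module _ (f : TotalColouring H) where
    open TotalColouring f

    colours : Vertex H → List ℕ
    colours v = vcol v ∷ map (ecol v) (neighbours v)

    ∈C⇒∈colours : ∀ {c v} → _∈C_ H f c v → c ∈ colours v
    ∈C⇒∈colours (inj₁ c≡vcol) = here c≡vcol
    ∈C⇒∈colours (inj₂ (u , vu , refl)) =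
      there (∈-map⁺ (ecol _) (∈-filter⁺ (λ w → adj _ w Bool.≟ true) (∈-allFin u) vu))

    length-colours : ∀ v → length (colours v) ≤ suc Δ
    length-colours v = s≤s (begin
      length (map (ecol v) (neighbours v))   ≡⟨ length-map (ecol v) (neighbours v) ⟩
      length (neighbours v)                  ≡⟨ length-neighbours v ⟩
      degree H v                             ≤⟨ degree≤maxDegree v ⟩
      Δ                                      ∎)
      where open ≤-Reasoning

    distinct-missing-colours : ∀ {K} → 2 + Δ < K → ∀ u₁ u₂ →
      ∃₂ λ a b → a ∈[ K ] × b ∈[ K ] × a ≢ b × ¬ _∈C_ H f a u₁ × ¬ _∈C_ H f b u₂
    distinct-missing-colours {K} 2+Δ<K u₁ u₂
      with b , b∈[K] , b∉ ← ∃-∈[]-∉ K (colours u₂) (<-trans (s≤s (length-colours u₂)) 2+Δ<K)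
      with a , a∈[K] , a∉ ← ∃-∈[]-∉ K (b ∷ colours u₁) (≤-<-trans (s≤s (length-colours u₁)) 2+Δ<K)
      = a , b , a∈[K] , b∈[K] , (λ a≡b → a∉ (here a≡b)) ,
        (λ a∈C → a∉ (there (∈C⇒∈colours a∈C))) , (b∉ ∘ ∈C⇒∈colours)

  module _ {π : ℕ → ℕ} (π-injective : Injective _≡_ _≡_ π) (f : TotalColouring H) where

    ∈C-recolour⁺ : ∀ {c v} → _∈C_ H f c v → _∈C_ H (recolour π f) (π c) v
    ∈C-recolour⁺ (inj₁ c≡vcol)       = inj₁ (cong π c≡vcol)
    ∈C-recolour⁺ (inj₂ (u , vu , eq)) = inj₂ (u , vu , cong π eq)

    ∈C-recolour⁻ : ∀ {c v} → _∈C_ H (recolour π f) (π c) v → _∈C_ H f c v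
    ∈C-recolour⁻ (inj₁ πc≡πvcol)       = inj₁ (π-injective πc≡πvcol)
    ∈C-recolour⁻ (inj₂ (u , vu , eq)) = inj₂ (u , vu , π-injective eq)

    ∉C-recolour : ∀ {c c′ v} → π c ≡ c′ → ¬ _∈C_ H f c v → ¬ _∈C_ H (recolour π f) c′ v
    ∉C-recolour refl c∉ = c∉ ∘ ∈C-recolour⁻

    recolour-avd : ∀ {k K} → (∀ {c} → c ∈[ k ] → π c ∈[ K ]) →
                   IsAvdTotal H f k → IsAvdTotal H (recolour π f) K
    recolour-avd π[k]⊆[K] ((vcol∈ , ecol∈ , ecol-sym , vcol-proper , ecol-proper , ecol≢vcol) , avd) =
      ( (π[k]⊆[K] ∘ vcol∈)
      , (λ u v uv → π[k]⊆[K] (ecol∈ u v uv))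
      , (λ u v uv → cong π (ecol-sym u v uv))
      , (λ u v uv → vcol-proper u v uv ∘ π-injective)
      , (λ u v w uv uw v≢w → ecol-proper u v w uv uw v≢w ∘ π-injective)
      , (λ u v uv → ecol≢vcol u v uv ∘ π-injective) )
      , λ u v uv same → avd u v uv λ c → mk⇔
          (λ c∈u → ∈C-recolour⁻ (Equivalence.to   (same (π c)) (∈C-recolour⁺ c∈u)))
          (λ c∈v → ∈C-recolour⁻ (Equivalence.from (same (π c)) (∈C-recolour⁺ c∈v)))

  module _ (u₁ u₂ : Vertex H) where

    top-colours-missing : ∀ {k f} → k ≤ Δ + 3 → IsAvdTotal H f k →
      Σ (TotalColouring H) λ g → IsAvdTotal H g (Δ + 3)
        × ¬ _∈C_ H g (Δ + 2) u₁ × ¬ _∈C_ H g (Δ + 3) u₂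
    top-colours-missing {k} {f} k≤Δ+3 f-avd
      with a , b , a∈[Δ+3] , b∈[Δ+3] , a≢b , a∉C , b∉C
           ← distinct-missing-colours f (subst (_< Δ + 3) (+-comm Δ 2) (n+2<n+3 Δ)) u₁ u₂
      = recolour τ f
      , recolour-avd τ-injective f (τ-preserves ∘ ∈[]-mono k≤Δ+3) f-avd
      , ∉C-recolour τ-injective f (transpose₂-fromˡ a≢b (<⇒≢ (n+2<n+3 Δ))) a∉C
      , ∉C-recolour τ-injective f (transpose₂-fromʳ {a} {Δ + 2} {b} {Δ + 3}) b∉C
      where
      τ : ℕ → ℕ
      τ = transpose₂ a (Δ + 2) b (Δ + 3)
      τ-injective : Injective _≡_ _≡_ τ
      τ-injective = transpose₂-injective {a} {Δ + 2} {b} {Δ + 3}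
      τ-preserves : ∀ {c} → c ∈[ Δ + 3 ] → τ c ∈[ Δ + 3 ]
      τ-preserves = transpose₂-preserves (_∈[ Δ + 3 ]) a∈[Δ+3] Δ+2∈[Δ+3] b∈[Δ+3] Δ+3∈[Δ+3]
        where
        Δ+2∈[Δ+3] : Δ + 2 ∈[ Δ + 3 ]
        Δ+2∈[Δ+3] = ≤-trans (s≤s z≤n) (m≤n+m 2 Δ) , <⇒≤ (n+2<n+3 Δ)
        Δ+3∈[Δ+3] : Δ + 3 ∈[ Δ + 3 ]
        Δ+3∈[Δ+3] = ≤-trans (s≤s z≤n) (m≤n+m 3 Δ) , ≤-refl

    vertex-colours-avoid : ∀ {g c} → 2 ≤ Δ → c ∈[ Δ + 1 ] → IsAvdTotal H g (Δ + 3)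
      → ¬ _∈C_ H g (Δ + 2) u₁ → ¬ _∈C_ H g (Δ + 3) u₂
      → Σ (TotalColouring H) λ h → IsAvdTotal H h (Δ + 3)
          × ¬ _∈C_ H h (Δ + 2) u₁ × ¬ _∈C_ H h (Δ + 3) u₂
          × TotalColouring.vcol h u₁ ≢ c × TotalColouring.vcol h u₂ ≢ c
    vertex-colours-avoid {g} {c} 2≤Δ (1≤c , c≤Δ+1) g-avd Δ+2∉C Δ+3∉C
      with d , (1≤d , d≤3) , d∉
           ← ∃-∈[]-∉ 3 (TotalColouring.vcol g u₁ ∷ TotalColouring.vcol g u₂ ∷ []) ≤-refl
      = recolour σ g
      , recolour-avd σ-injective g σ-preserves g-avd
      , ∉C-recolour σ-injective g (σ-fixes (+-monoʳ-< Δ (n<1+n 1))) Δ+2∉C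
      , ∉C-recolour σ-injective g (σ-fixes (+-monoʳ-< Δ (s≤s (s≤s z≤n)))) Δ+3∉C
      , transpose-≢ˡ {c} {d} (λ vcol≡d → d∉ (here (sym vcol≡d)))
      , transpose-≢ˡ {c} {d} (λ vcol≡d → d∉ (there (here (sym vcol≡d))))
      where
      σ : ℕ → ℕ
      σ = transpose c d
      σ-injective : Injective _≡_ _≡_ σ
      σ-injective = transpose-injective {c} {d}
      d≤Δ+1 : d ≤ Δ + 1
      d≤Δ+1 = ≤-trans d≤3 (+-monoˡ-≤ 1 2≤Δ)
      σ-fixes : ∀ {x} → Δ + 1 < x → σ x ≡ x
      σ-fixes Δ+1<x = transpose-fix (>⇒≢ (≤-<-trans c≤Δ+1 Δ+1<x)) (>⇒≢ (≤-<-trans d≤Δ+1 Δ+1<x))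
      σ-preserves : ∀ {x} → x ∈[ Δ + 3 ] → σ x ∈[ Δ + 3 ]
      σ-preserves = transpose-preserves (_∈[ Δ + 3 ]) (widen (1≤c , c≤Δ+1)) (widen (1≤d , d≤Δ+1))
        where
        widen : ∀ {x} → x ∈[ Δ + 1 ] → x ∈[ Δ + 3 ]
        widen = ∈[]-mono (+-monoʳ-≤ Δ (s≤s z≤n))

proposition4 : (H : Graph) → Connected H → 3 ≤ maxDegree H
    → ChiAvdAtMost H (maxDegree H + 3)
    → IndependenceAtLeast2 H
    → (u₁ u₂ : Vertex H) → u₁ ≢ u₂ → ¬ Edge H u₁ u₂
    → (c : ℕ) → InRange H (maxDegree H + 1) c
    → Σ (TotalColouring H) λ f →
        IsAvdTotal H f (maxDegree H + 3)
        × ¬ (_∈C_ H f (maxDegree H + 2) u₁)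
        × ¬ (_∈C_ H f (maxDegree H + 3) u₂)
        × TotalColouring.vcol f u₁ ≢ c
        × TotalColouring.vcol f u₂ ≢ c
proposition4 H _ 3≤Δ (k , k≤Δ+3 , f , f-avd) _ u₁ u₂ _ _ c c∈[Δ+1] =
  let g , g-avd , Δ+2∉C , Δ+3∉C = top-colours-missing H u₁ u₂ k≤Δ+3 f-avd
  in  vertex-colours-avoid H u₁ u₂ (≤-trans (n≤1+n 2) 3≤Δ) c∈[Δ+1] g-avd Δ+2∉C Δ+3∉C
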